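{- Let $S$ be a set and $\to\subseteq S\times S$ a binary relation. Let $P,P',Q,Q'\subseteq S$, $F,F'\subseteq S\times S$ and $c_0,c_1:S\to\mathbb{N}$. If $\mathrm{EnsuresN}_{\to}(P,Q,F,c_0)$ and $\mathrm{EnsuresN}_{\to}(P',Q',F',c_1)$ hold, then $\mathrm{Ensures2}_{\to}(P\times P',Q\times Q',F\otimes F',c_0,c_1)$ holds, where $F\otimes F'=\{((s_0,s_1),(s_0',s_1'))\mid (s_0,s_0')\in F\wedge(s_1,s_1')\in F'\}$.
   Context: For $n\in\mathbb{N}$, $\to^n$ denotes the $n$-fold composition of $\to$, with $\to^0$ the identity relation on $S$. For $n\in\mathbb{N}$ and $Q\subseteq S$, $\mathrm{EvN}_{\to}(n,Q)=\{s\in S\mid (\forall s'.\ s\to^n s'\Rightarrow s'\in Q)\wedge(\forall s'\,\forall l<n.\ s\to^l s'\Rightarrow\exists s''.\ s'\to s'')\}$. $\mathrm{EnsuresN}_{\to}(P,Q,F,c)$ (for $P,Q\subseteq S$, $F\subseteq S\times S$, $c:S\to\mathbb{N}$) means: for all $s\in P$, $s\in\mathrm{EvN}_{\to}(c(s),\{s'\mid s'\in Q\wedge(s,s')\in F\})$. For $P,Q\subseteq S\times S$, $F\subseteq(S\times S)\times(S\times S)$ and $c_0,c_1:S\to\mathbb{N}$, $\mathrm{Ensures2}_{\to}(P,Q,F,c_0,c_1)$ means: for all $(s_0,s_1)\in P$, $s_0\in\mathrm{EvN}_{\to}\big(c_0(s_0),\{s_0'\mid s_1\in\mathrm{EvN}_{\to}(c_1(s_1),\{s_1'\mid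 (s_0',s_1')\in Q\wedge((s_0,s_1),(s_0',s_1'))\in F\})\}\big)$. -}

module Defs where

open import Level using (Level; _⊔_)
open import Data.Nat using (ℕ; zero; suc; _<_)
open import Data.Product using (_×_; _,_; Σ; ∃; proj₁; proj₂)
open import Relation.Binary.PropositionalEquality using (_≡_)

Pred : ∀ {a} → Set a → (ℓ : Level) → Set (a ⊔ Level.suc ℓ)
Pred S ℓ = S → Set ℓ

Rel : ∀ {a} → Set a → (ℓ : Level) → Set (a ⊔ Level.suc ℓ)
Rel S ℓ = S → S → Set ℓ

module _ {a ℓ : Level} {S : Set a} where

  Iter : Rel S ℓ → ℕ → S → S → Set (a ⊔ ℓ)
  Iter _⟶_ zero    s s' = Level.Lift ℓ (s ≡ s')
  Iter _⟶_ (suc n) s s' = Σ S (λ t → (s ⟶ t) × Iter _⟶_ n t s')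

  EvN : ∀ {q} → Rel S ℓ → ℕ → Pred S q → Pred S (a ⊔ ℓ ⊔ q)
  EvN _⟶_ n Q s =
    (∀ s' → Iter _⟶_ n s s' → Q s')
    × (∀ s' l → l < n → Iter _⟶_ l s s' → Σ S (λ s'' → s' ⟶ s''))

  EnsuresN : ∀ {p q f} → Rel S ℓ → Pred S p → Pred S q → Rel S f → (S → ℕ) → Set (a ⊔ ℓ ⊔ p ⊔ q ⊔ f)
  EnsuresN _⟶_ P Q F c = ∀ s → P s → EvN _⟶_ (c s) (λ s' → Q s' × F s s') s

  Ensures2 : ∀ {p q f} → Rel S ℓ → Pred (S × S) p → Pred (S × S) q → Rel (S × S) f
           → (S → ℕ) → (S → ℕ) → Set (a ⊔ ℓ ⊔ p ⊔ q ⊔ f)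
  Ensures2 _⟶_ P Q F c₀ c₁ =
    ∀ s₀ s₁ → P (s₀ , s₁) →
      EvN _⟶_ (c₀ s₀)
        (λ s₀' → EvN _⟶_ (c₁ s₁) (λ s₁' → Q (s₀' , s₁') × F (s₀ , s₁) (s₀' , s₁')) s₁)
        s₀

module _ {a : Level} {S : Set a} where

  _⊠_ : ∀ {p p'} → Pred S p → Pred S p' → Pred (S × S) (p ⊔ p')
  (P ⊠ P') s = P (proj₁ s) × P' (proj₂ s)

  _⊗_ : ∀ {f f'} → Rel S f → Rel S f' → Rel (S × S) (f ⊔ f')
  (F ⊗ F') s s' = F (proj₁ s) (proj₁ s') × F' (proj₂ s) (proj₂ s')

{-# OPTIONS --safe #-}
module Submission where

open import Defs
open import Level using (Level)
open import Data.Nat using (ℕ)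
open import Data.Product using (_,_)
open import Relation.Unary using (_⊆_)

EvN-mono : ∀ {a ℓ q q'} {S : Set a} {_⟶_ : Rel S ℓ} {Q : Pred S q} {Q' : Pred S q'} {n : ℕ} →
           Q ⊆ Q' → EvN _⟶_ n Q ⊆ EvN _⟶_ n Q'
EvN-mono Q⊆Q' (reaches , progresses) = (λ s' steps → Q⊆Q' (reaches s' steps)) , progresses

theorem3 : ∀ {a ℓ p p' q q' f f' : Level} {S : Set a} (_⟶_ : Rel S ℓ)
           (P : Pred S p) (P' : Pred S p') (Q : Pred S q) (Q' : Pred S q')
           (F : Rel S f) (F' : Rel S f') (c₀ c₁ : S → ℕ) →
           EnsuresN _⟶_ P Q F c₀ → EnsuresN _⟶_ P' Q' F' c₁ →
           Ensures2 _⟶_ (P ⊠ P') (Q ⊠ Q') (F ⊗ F') c₀ c₁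
theorem3 _⟶_ P P' Q Q' F F' c₀ c₁ ensures₀ ensures₁ s₀ s₁ (p₀ , p₁) =
  EvN-mono (λ (q₀ , f₀) → EvN-mono (λ (q₁ , f₁) → (q₀ , q₁) , (f₀ , f₁)) (ensures₁ s₁ p₁))
           (ensures₀ s₀ p₀)
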